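{- The interpretability logic $\mathsf{ILM}$ is sound for conversely well-founded provability models (for the language $\mathcal L_\rhd$) with necessitation: if $\mathsf{ILM}\vdash A$ and $\mathcal P$ is such a model, then $\mathcal P,w\Vdash A$ for every world $w$ of $\mathcal P$.
   Context: Language $\mathcal L_\rhd$: formulas built from atomic propositions and $\bot$ using $\to$ and a binary modal operator $\rhd$; $\neg A:=A\to\bot$, other Boolean connectives defined classically, $\Box A:=\neg A\rhd\bot$, $\Diamond A:=\neg\Box\neg A$. A formula is purely modal if it is a Boolean combination of formulas of the form $B\rhd C$. $\mathsf{ILM}$ is the logic in $\mathcal L_\rhd$ whose only rule is modus ponens and whose axioms are: all theorems of $\mathsf{GL}$ (i.e. $\mathsf K$ plus $\Box A\to\Box\Box A$ and $\Box(\Box A\to A)\to\Box A$, formulated over $\mathcal L_\rhd$); $\Box(A\to B)\to A\rhd B$; $(A\rhd B\wedge B\rhd C)\to A\rhd C$; $(B\rhd A\wedge C\rhd A)\to(B\vee C)\rhd A$; $\Diamond A\rhd A$; $A\rhd B\to((\Box C\wedge A)\rhd(\Box C\wedge B))$; and $\Box X$ for $X$ any instance of the previous five schemes. A theory is a pair of a set of axioms and a set of inference rules (finitely many premises, one conclusion) over $\mathcal L_\rhd$; $\mathsf T\vdash A$ means derivability. A theory is classical if modus ponens is one of its rules and all classical tautologies are derivable. A provability pre-model is $\mathcal P=(W,\sqsubset,\{L_w\}_{w\in W^\sqsubset},V)$ with $W$ nonempty, $\sqsubset$ a binary relation on $W$, $V\subseteq W\times\mathrm{atoms}$, $W^\sqsubset=\{u:\exists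 v\,(v\sqsubset u)\}$, and a theory $L_w$ over $\mathcal L_\rhd$ for each $w\in W^\sqsubset$. Satisfaction: atoms via $V$, $\bot$ never holds, $\to$ classical, and $\mathcal P,w\Vdash A\rhd B$ iff for every $u$ with $w\sqsubset u$ and every formula $E$, $L_u\vdash B\to\Diamond E$ implies $L_u\vdash A\to\Diamond E$. With $\sqsubset^+$ the transitive closure, $\mathcal P,w\Vdash^+A$ iff there is $u\sqsubset w$ with $\mathcal P,v\Vdash A$ for all $v$ with $u\sqsubset^+v$. A provability model is a pre-model in which every $L_w$ is classical and modal completeness holds: for every $w\in W^\sqsubset$ and purely modal $A$, $\mathcal P,w\Vdash^+A$ implies $L_w\vdash A$. Necessitation: every $L_w$ has the rule "from $A$ infer $\Box A$". Conversely well-founded: no infinite chain $w_0\sqsubset w_1\sqsubset\cdots$. -}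

module Defs where

open import Data.Nat using (ℕ; suc)
open import Data.Bool using (Bool; true; false; _∨_; not)
open import Data.List using (List; []; _∷_)
open import Data.List.Relation.Unary.All using (All)
open import Data.Product using (Σ; ∃; _×_; _,_)
open import Data.Empty using (⊥)
open import Relation.Nullary using (¬_)
open import Relation.Binary.PropositionalEquality using (_≡_)
open import Relation.Binary.Construct.Closure.Transitive using (TransClosure)

infixr 5 _⇒_
infix  7 _▷_
infixr 6 _∧'_ _∨'_

data Fm : Set where
  atom : ℕ → Fm
  ⊥'   : Fm
  _⇒_  : Fm → Fm → Fm
  _▷_  : Fm → Fm → Fm

¬' : Fm → Fm
¬' A = A ⇒ ⊥'

_∨'_ : Fm → Fm → Fm
A ∨' B = ¬' A ⇒ B

_∧'_ : Fm → Fm → Fm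
A ∧' B = ¬' (A ⇒ ¬' B)

□ : Fm → Fm
□ A = ¬' A ▷ ⊥'

◇ : Fm → Fm
◇ A = ¬' (□ (¬' A))

data PurelyModal : Fm → Set where
  pm▷ : ∀ {B C} → PurelyModal (B ▷ C)
  pm⊥ : PurelyModal ⊥'
  pm⇒ : ∀ {A B} → PurelyModal A → PurelyModal B → PurelyModal (A ⇒ B)

-- Classical tautologies: true under every Boolean valuation in which
-- atoms and ▷-formulas are treated as propositional variables.

eval : (ℕ → Bool) → (Fm → Fm → Bool) → Fm → Bool
eval v r (atom p) = v p
eval v r ⊥'       = false
eval v r (A ⇒ B)  = not (eval v r A) ∨ eval v r B
eval v r (A ▷ B)  = r A B

Tautology : Fm → Set
Tautology A = ∀ v r → eval v r A ≡ true

data GL⊢ : Fm → Set where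
  taut : ∀ {A} → Tautology A → GL⊢ A
  K    : ∀ {A B} → GL⊢ (□ (A ⇒ B) ⇒ □ A ⇒ □ B)
  four : ∀ {A} → GL⊢ (□ A ⇒ □ (□ A))
  löb  : ∀ {A} → GL⊢ (□ (□ A ⇒ A) ⇒ □ A)
  mp   : ∀ {A B} → GL⊢ A → GL⊢ (A ⇒ B) → GL⊢ B
  nec  : ∀ {A} → GL⊢ A → GL⊢ (□ A)

data ILMScheme : Fm → Set where
  J1 : ∀ {A B}   → ILMScheme (□ (A ⇒ B) ⇒ A ▷ B)
  J2 : ∀ {A B C} → ILMScheme ((A ▷ B ∧' B ▷ C) ⇒ A ▷ C)
  J3 : ∀ {A B C} → ILMScheme ((B ▷ A ∧' C ▷ A) ⇒ (B ∨' C) ▷ A)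
  J5 : ∀ {A}     → ILMScheme (◇ A ▷ A)
  M  : ∀ {A B C} → ILMScheme (A ▷ B ⇒ (□ C ∧' A) ▷ (□ C ∧' B))

data ILM⊢ : Fm → Set where
  gl     : ∀ {A} → GL⊢ A → ILM⊢ A
  scheme : ∀ {A} → ILMScheme A → ILM⊢ A
  boxSch : ∀ {A} → ILMScheme A → ILM⊢ (□ A)
  mp     : ∀ {A B} → ILM⊢ A → ILM⊢ (A ⇒ B) → ILM⊢ B

record Theory : Set₁ where
  field
    Axiom : Fm → Set
    Rule  : List Fm → Fm → Set

data _⊢_ (T : Theory) : Fm → Set where
  ax   : ∀ {A} → Theory.Axiom T A → T ⊢ A
  rule : ∀ {Γ A} → Theory.Rule T Γ A → All (T ⊢_) Γ → T ⊢ A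

Classical : Theory → Set
Classical T = (∀ A B → Theory.Rule T (A ∷ (A ⇒ B) ∷ []) B)
            × (∀ A → Tautology A → T ⊢ A)

record PreModel : Set₁ where
  field
    W   : Set
    _⊏_ : W → W → Set
    L   : W → Theory   -- only the values on W^⊏ are ever used
    V   : W → ℕ → Set
    inhabited : W

module _ (P : PreModel) where
  open PreModel P

  InW⊏ : W → Set
  InW⊏ u = ∃ λ v → v ⊏ u

  _⊩_ : W → Fm → Set
  w ⊩ atom p = V w p
  w ⊩ ⊥'     = ⊥
  w ⊩ (A ⇒ B) = w ⊩ A → w ⊩ B
  w ⊩ (A ▷ B) = ∀ u → w ⊏ u → ∀ E → L u ⊢ (B ⇒ ◇ E) → L u ⊢ (A ⇒ ◇ E)

  _⊩⁺_ : W → Fm → Set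
  w ⊩⁺ A = ∃ λ u → u ⊏ w × (∀ v → TransClosure _⊏_ u v → v ⊩ A)

  IsProvabilityModel : Set
  IsProvabilityModel =
      (∀ w → InW⊏ w → Classical (L w))
    × (∀ w → InW⊏ w → ∀ A → PurelyModal A → w ⊩⁺ A → L w ⊢ A)

  HasNecessitation : Set
  HasNecessitation = ∀ w → InW⊏ w → ∀ A → Theory.Rule (L w) (A ∷ []) (□ A)

  ConverselyWellFounded : Set
  ConverselyWellFounded = ¬ (Σ (ℕ → W) λ f → ∀ n → f n ⊏ f (suc n))

-- Soundness is proved by induction along the converse of ⊏, which is
-- well-founded (classically) because there are no infinite ascending
-- chains. If all worlds above w validate ILM, then modal completeness puts
-- every purely modal ILM theorem, hence (with necessitation and modus
-- ponens) every ILM theorem, into each theory L u with w ⊏ u. In such a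
-- theory the semantic clause of ▷ is a relation on formulas that satisfies
-- J1, J2, J3, J5 and M by purely syntactic reasoning, so every ILM axiom
-- holds at w.

module Submission where

open import Defs
open import Level using (0ℓ)
open import Axiom.ExcludedMiddle using (ExcludedMiddle)
open import Data.Nat using (ℕ; zero; suc)
open import Data.Nat.GeneralisedArithmetic using (fold)
open import Data.Bool using (Bool; true; false; _∨_; _∧_; not) renaming (T to IsTrue)
open import Data.Bool.Properties using (T-∧; T-≡)
open import Data.Vec using (Vec; []; _∷_; lookup; map)
open import Data.Vec.Properties using (lookup-map)
open import Data.Fin using (Fin; zero; suc)
open import Data.List using ([]; _∷_)
open import Data.List.Relation.Unary.All using ([]; _∷_)
open import Data.Product using (Σ; _×_; _,_; proj₁; proj₂)
open import Function using (_∘_; Equivalence)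
open import Relation.Nullary using (¬_; does; proof)
open import Relation.Nullary.Decidable using (decidable-stable)
open import Relation.Nullary.Reflects using (Reflects; ofⁿ; invert; _→-reflects_)
open import Relation.Binary.PropositionalEquality using (_≡_; refl; cong₂; trans; sym; subst)
open import Relation.Binary.Construct.Closure.Transitive using (TransClosure; [_]; _∷_)

module _ (lem : ExcludedMiddle 0ℓ) {W : Set} {_<_ : W → W → Set}
         (noAscendingChain : ¬ Σ (ℕ → W) λ f → ∀ n → f n < f (suc n)) where

  cwf-induction : (P : W → Set) → (∀ w → (∀ u → w < u → P u) → P w) → ∀ w → P w
  cwf-induction P step w = decidable-stable lem λ ¬Pw → noAscendingChain (ascending (w , ¬Pw))
    where
    Counterexample : Set
    Counterexample = Σ W (¬_ ∘ P)

    larger : (c : Counterexample) → Σ Counterexample λ c′ → proj₁ c < proj₁ c′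
    larger (w , ¬Pw) = decidable-stable lem λ noneLarger →
      ¬Pw (step w λ u w<u → decidable-stable lem λ ¬Pu → noneLarger ((u , ¬Pu) , w<u))

    ascending : Counterexample → Σ (ℕ → W) λ f → ∀ n → f n < f (suc n)
    ascending c = proj₁ ∘ chain , proj₂ ∘ larger ∘ chain
      where
      chain : ℕ → Counterexample
      chain = fold c (proj₁ ∘ larger)

  cwf-induction⁺ : (P : W → Set) → (∀ w → (∀ v → TransClosure _<_ w v → P v) → P w) →
                   ∀ w → P w
  cwf-induction⁺ P step w = step w (cwf-induction Above above w)
    where
    Above : W → Set
    Above w = ∀ v → TransClosure _<_ w v → P v

    above : ∀ w → (∀ u → w < u → Above u) → Above w
    above w ih v [ w<v ]       = step v (ih v w<v)
    above w ih v (w<u ∷ u<⁺v) = ih _ w<u v u<⁺v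

-- Instances of propositional tautologies, checked by truth tables.

infixr 5 _⇛_
infixr 6 _&_

data PForm (n : ℕ) : Set where
  var : Fin n → PForm n
  bot : PForm n
  _⇛_ : PForm n → PForm n → PForm n

~_ : ∀ {n} → PForm n → PForm n
~ a = a ⇛ bot

_&_ : ∀ {n} → PForm n → PForm n → PForm n
a & b = ~ (a ⇛ ~ b)

x₀ : ∀ {n} → PForm (suc n)
x₀ = var zero

x₁ : ∀ {n} → PForm (suc (suc n))
x₁ = var (suc zero)

x₂ : ∀ {n} → PForm (suc (suc (suc n)))
x₂ = var (suc (suc zero))

x₃ : ∀ {n} → PForm (suc (suc (suc (suc n))))
x₃ = var (suc (suc (suc zero)))

⟦_⟧ : ∀ {n} → PForm n → Vec Fm n → Fm
⟦ var i ⟧ σ = lookup σ i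
⟦ bot ⟧   σ = ⊥'
⟦ a ⇛ b ⟧ σ = ⟦ a ⟧ σ ⇒ ⟦ b ⟧ σ

evalP : ∀ {n} → Vec Bool n → PForm n → Bool
evalP ρ (var i) = lookup ρ i
evalP ρ bot     = false
evalP ρ (a ⇛ b) = not (evalP ρ a) ∨ evalP ρ b

eval-⟦⟧ : ∀ {n} v r (σ : Vec Fm n) φ → eval v r (⟦ φ ⟧ σ) ≡ evalP (map (eval v r) σ) φ
eval-⟦⟧ v r σ (var i) = sym (lookup-map i (eval v r) σ)
eval-⟦⟧ v r σ bot     = refl
eval-⟦⟧ v r σ (a ⇛ b) = cong₂ (λ x y → not x ∨ y) (eval-⟦⟧ v r σ a) (eval-⟦⟧ v r σ b)

forAllValuations : ∀ n → (Vec Bool n → Bool) → Bool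
forAllValuations zero    f = f []
forAllValuations (suc n) f = forAllValuations n (f ∘ (true ∷_)) ∧ forAllValuations n (f ∘ (false ∷_))

forAllValuations-sound : ∀ n f → IsTrue (forAllValuations n f) → ∀ ρ → IsTrue (f ρ)
forAllValuations-sound zero    f holds [] = holds
forAllValuations-sound (suc n) f holds (true ∷ ρ) =
  forAllValuations-sound n _ (proj₁ (Equivalence.to T-∧ holds)) ρ
forAllValuations-sound (suc n) f holds (false ∷ ρ) =
  forAllValuations-sound n _ (proj₂ (Equivalence.to T-∧ holds)) ρ

IsTautology : ∀ {n} → PForm n → Bool
IsTautology {n} φ = forAllValuations n (λ ρ → evalP ρ φ)

⟦⟧-tautology : ∀ {n} (φ : PForm n) → IsTrue (IsTautology φ) → (σ : Vec Fm n) → Tautology (⟦ φ ⟧ σ)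
⟦⟧-tautology {n} φ holds σ v r = trans (eval-⟦⟧ v r σ φ) (Equivalence.to T-≡ (forAllValuations-sound n _ holds _))

PurelyModal-∧ : ∀ {A B} → PurelyModal A → PurelyModal B → PurelyModal (A ∧' B)
PurelyModal-∧ pmA pmB = pm⇒ (pm⇒ pmA (pm⇒ pmB pm⊥)) pm⊥

ILMScheme⇒PurelyModal : ∀ {A} → ILMScheme A → PurelyModal A
ILMScheme⇒PurelyModal J1 = pm⇒ pm▷ pm▷
ILMScheme⇒PurelyModal J2 = pm⇒ (PurelyModal-∧ pm▷ pm▷) pm▷
ILMScheme⇒PurelyModal J3 = pm⇒ (PurelyModal-∧ pm▷ pm▷) pm▷
ILMScheme⇒PurelyModal J5 = pm▷
ILMScheme⇒PurelyModal M  = pm⇒ pm▷ pm▷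

Necessitation : Theory → Set
Necessitation T = ∀ A → Theory.Rule T (A ∷ []) (□ A)

ContainsGL : Theory → Set
ContainsGL T = ∀ {A} → GL⊢ A → T ⊢ A

ContainsILM : Theory → Set
ContainsILM T = ∀ {A} → ILM⊢ A → T ⊢ A

_▷⟨_⟩_ : Fm → Theory → Fm → Set
A ▷⟨ T ⟩ B = ∀ E → T ⊢ (B ⇒ ◇ E) → T ⊢ (A ⇒ ◇ E)

▷⟨⟩-trans : ∀ {T A B C} → A ▷⟨ T ⟩ B → B ▷⟨ T ⟩ C → A ▷⟨ T ⟩ C
▷⟨⟩-trans A▷B B▷C E = A▷B E ∘ B▷C E

module ClassicalTheory {T : Theory} (classical : Classical T) where

  ⊢-mp : ∀ {A B} → T ⊢ (A ⇒ B) → T ⊢ A → T ⊢ B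
  ⊢-mp {A} {B} A⇒B a = rule (proj₁ classical A B) (a ∷ A⇒B ∷ [])

  ⊢-mp₂ : ∀ {A B C} → T ⊢ (A ⇒ B ⇒ C) → T ⊢ A → T ⊢ B → T ⊢ C
  ⊢-mp₂ f a = ⊢-mp (⊢-mp f a)

  tautology : ∀ {n} (φ : PForm n) (σ : Vec Fm n) {_ : IsTrue (IsTautology φ)} → T ⊢ ⟦ φ ⟧ σ
  tautology φ σ {holds} = proj₂ classical _ (⟦⟧-tautology φ holds σ)

  ⊢-⇒-trans : ∀ {A B C} → T ⊢ (A ⇒ B) → T ⊢ (B ⇒ C) → T ⊢ (A ⇒ C)
  ⊢-⇒-trans {A} {B} {C} = ⊢-mp₂ (tautology ((x₀ ⇛ x₁) ⇛ (x₁ ⇛ x₂) ⇛ (x₀ ⇛ x₂)) (A ∷ B ∷ C ∷ []))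

  ⊢-contrapose : ∀ {A B} → T ⊢ (A ⇒ B) → T ⊢ (¬' B ⇒ ¬' A)
  ⊢-contrapose {A} {B} = ⊢-mp (tautology ((x₀ ⇛ x₁) ⇛ (~ x₁ ⇛ ~ x₀)) (A ∷ B ∷ []))

  ⊢⇒-to-▷ : ∀ {A B} → T ⊢ (A ⇒ B) → A ▷⟨ T ⟩ B
  ⊢⇒-to-▷ A⇒B E = ⊢-⇒-trans A⇒B

  ▷⟨⟩-join : ∀ {A B C} → B ▷⟨ T ⟩ A → C ▷⟨ T ⟩ A → (B ∨' C) ▷⟨ T ⟩ A
  ▷⟨⟩-join {A} {B} {C} B▷A C▷A E A⇒◇E =
    ⊢-mp₂ (tautology ((x₀ ⇛ x₂) ⇛ (x₁ ⇛ x₂) ⇛ ((~ x₀ ⇛ x₁) ⇛ x₂)) (B ∷ C ∷ ◇ E ∷ []))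
          (B▷A E A⇒◇E) (C▷A E A⇒◇E)

  module _ (necessitation : Necessitation T) where

    ⊢-nec : ∀ {A} → T ⊢ A → T ⊢ □ A
    ⊢-nec {A} a = rule (necessitation A) (a ∷ [])

    containsILM-from-purelyModal : (∀ {A} → ILM⊢ A → PurelyModal A → T ⊢ A) → ContainsILM T
    containsILM-from-purelyModal pm = ilm
      where
      glT : ContainsGL T
      glT (taut t) = proj₂ classical _ t
      glT K        = pm (gl K) (pm⇒ pm▷ (pm⇒ pm▷ pm▷))
      glT four     = pm (gl four) (pm⇒ pm▷ pm▷)
      glT löb      = pm (gl löb) (pm⇒ pm▷ pm▷)
      glT (mp d e) = ⊢-mp (glT e) (glT d)
      glT (nec d)  = ⊢-nec (glT d)

      ilm : ContainsILM T
      ilm (gl d)     = glT d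
      ilm (scheme s) = pm (scheme s) (ILMScheme⇒PurelyModal s)
      ilm (boxSch s) = pm (boxSch s) pm▷
      ilm (mp d e)   = ⊢-mp (ilm e) (ilm d)

    module _ (containsGL : ContainsGL T) where

      ⊢□-mono : ∀ {A B} → T ⊢ (A ⇒ B) → T ⊢ (□ A ⇒ □ B)
      ⊢□-mono A⇒B = ⊢-mp (containsGL K) (⊢-nec A⇒B)

      -- □¬E → □□¬E → □¬◇E → □¬A, then contrapose.
      ◇▷⟨⟩ : ∀ {A} → ◇ A ▷⟨ T ⟩ A
      ◇▷⟨⟩ {A} E A⇒◇E = ⊢-contrapose
        (⊢-⇒-trans (containsGL four)
          (⊢-⇒-trans (⊢□-mono (tautology (x₀ ⇛ ~ ~ x₀) (□ (¬' E) ∷ [])))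
                     (⊢□-mono (⊢-contrapose A⇒◇E))))

      -- With F = C ⇒ E we have □¬F ↔ □C ∧ □¬E, so the hypothesis turns
      -- □C ∧ B ⇒ ◇E into B ⇒ ◇F, and A ⇒ ◇F back into □C ∧ A ⇒ ◇E.
      ▷⟨⟩-□∧ : ∀ {A B C} → A ▷⟨ T ⟩ B → (□ C ∧' A) ▷⟨ T ⟩ (□ C ∧' B)
      ▷⟨⟩-□∧ {A} {B} {C} A▷B E □C∧B⇒◇E =
        ⊢-mp₂ (tautology ((x₃ ⇛ ~ x₂) ⇛ (x₀ ⇛ x₁ ⇛ x₂) ⇛ ((x₀ & x₃) ⇛ ~ x₁)) (□ C ∷ □¬E ∷ □¬F ∷ A ∷ []))
              (A▷B F B⇒◇F) □C⇒□¬E⇒□¬F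
        where
        F □¬E □¬F : Fm
        F   = C ⇒ E
        □¬E = □ (¬' E)
        □¬F = □ (¬' F)

        B⇒◇F : T ⊢ (B ⇒ ◇ F)
        B⇒◇F = ⊢-mp
          (⊢-mp₂ (tautology (((x₀ & x₁) ⇛ ~ x₂) ⇛ (x₃ ⇛ x₀) ⇛ (x₃ ⇛ x₂) ⇛ (x₁ ⇛ ~ x₃)) (□ C ∷ B ∷ □¬E ∷ □¬F ∷ []))
                 □C∧B⇒◇E (⊢□-mono (tautology (~ (x₀ ⇛ x₁) ⇛ x₀) (C ∷ E ∷ []))))
          (⊢□-mono (tautology (~ (x₀ ⇛ x₁) ⇛ ~ x₁) (C ∷ E ∷ [])))

        □C⇒□¬E⇒□¬F : T ⊢ (□ C ⇒ □¬E ⇒ □¬F)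
        □C⇒□¬E⇒□¬F = ⊢-⇒-trans (⊢□-mono (tautology (x₀ ⇛ ~ x₁ ⇛ ~ (x₀ ⇛ x₁)) (C ∷ E ∷ []))) (containsGL K)

module ProvabilityModel (lem : ExcludedMiddle 0ℓ) (P : PreModel) (isModel : IsProvabilityModel P)
                        (necessitation : HasNecessitation P) where
  open PreModel P

  infix 4 _⊨_
  _⊨_ : W → Fm → Set
  _⊨_ = _⊩_ P

  classicalAt : ∀ {w u} → w ⊏ u → Classical (L u)
  classicalAt {w} w⊏u = proj₁ isModel _ (w , w⊏u)

  necessitationAt : ∀ {w u} → w ⊏ u → Necessitation (L u)
  necessitationAt {w} w⊏u = necessitation _ (w , w⊏u)

  completeAt : ∀ {w u} → w ⊏ u → ∀ {A} → PurelyModal A → _⊩⁺_ P u A → L u ⊢ A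
  completeAt {w} w⊏u pmA = proj₂ isModel _ (w , w⊏u) _ pmA

  ⊨-reflects : ∀ w A → Reflects (w ⊨ A)
                 (eval (λ p → does (lem {w ⊨ atom p})) (λ A B → does (lem {w ⊨ A ▷ B})) A)
  ⊨-reflects w (atom p) = proof lem
  ⊨-reflects w ⊥'       = ofⁿ λ ()
  ⊨-reflects w (A ⇒ B)  = ⊨-reflects w A →-reflects ⊨-reflects w B
  ⊨-reflects w (A ▷ B)  = proof lem

  ⊨-tautology : ∀ {w A} → Tautology A → w ⊨ A
  ⊨-tautology {w} {A} t = invert (subst (Reflects (w ⊨ A)) (t _ _) (⊨-reflects w A))

  ⊨∧-elim : ∀ {w A B} → w ⊨ (A ∧' B) → (w ⊨ A) × (w ⊨ B)
  ⊨∧-elim A∧B = decidable-stable lem (λ ¬A → A∧B λ a _ → ¬A a)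
              , decidable-stable lem (λ ¬B → A∧B λ _ b → ¬B b)

  ⊨□-intro : ∀ {w X} → (∀ u → w ⊏ u → L u ⊢ X) → w ⊨ □ X
  ⊨□-intro {X = X} ⊢X u w⊏u E _ = ⊢-mp (tautology (x₀ ⇛ ~ x₀ ⇛ x₁) (X ∷ ◇ E ∷ [])) (⊢X u w⊏u)
    where open ClassicalTheory (classicalAt w⊏u)

  ⊢□⊤ : ∀ {w u} → w ⊏ u → L u ⊢ □ (¬' ⊥')
  ⊢□⊤ {w} w⊏u = completeAt w⊏u pm▷ (w , w⊏u , λ v _ → ⊨□-intro λ x v⊏x →
                  ClassicalTheory.tautology (classicalAt v⊏x) (~ bot) [])

  -- Taking E = ⊥ in the clause for ¬X ▷ ⊥ gives ¬X ⇒ ◇⊥, i.e. ¬X ⇒ ¬□⊤.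
  ⊨□-elim : ∀ {w u X} → w ⊨ □ X → w ⊏ u → L u ⊢ X
  ⊨□-elim {u = u} {X} □X w⊏u =
    ⊢-mp₂ (tautology ((~ x₀ ⇛ ~ x₁) ⇛ x₁ ⇛ x₀) (X ∷ □ (¬' ⊥') ∷ []))
          (□X u w⊏u ⊥' (tautology (bot ⇛ x₀) (◇ ⊥' ∷ [])))
          (⊢□⊤ w⊏u)
    where open ClassicalTheory (classicalAt w⊏u)

  Valid : W → Set
  Valid w = ∀ {A} → ILM⊢ A → w ⊨ A

  module _ (w : W) (containsILM : ∀ {u} → w ⊏ u → ContainsILM (L u)) where

    private
      containsGL : ∀ {u} → w ⊏ u → ContainsGL (L u)
      containsGL w⊏u = containsILM w⊏u ∘ gl

    GL-sound : ∀ {A} → GL⊢ A → w ⊨ A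
    GL-sound (taut {A} t) = ⊨-tautology {A = A} t
    GL-sound K □A⇒B □A = ⊨□-intro λ u w⊏u →
      ClassicalTheory.⊢-mp (classicalAt w⊏u) (⊨□-elim □A⇒B w⊏u) (⊨□-elim □A w⊏u)
    GL-sound four □A   = ⊨□-intro λ u w⊏u →
      ClassicalTheory.⊢-nec (classicalAt w⊏u) (necessitationAt w⊏u) (⊨□-elim □A w⊏u)
    GL-sound löb □[□A⇒A] = ⊨□-intro λ u w⊏u →
      let open ClassicalTheory (classicalAt w⊏u)
          □A⇒A = ⊨□-elim □[□A⇒A] w⊏u
      in ⊢-mp □A⇒A (⊢-mp (containsGL w⊏u löb) (⊢-nec (necessitationAt w⊏u) □A⇒A))
    GL-sound (mp d e)  = GL-sound e (GL-sound d)
    GL-sound (nec d)   = ⊨□-intro λ u w⊏u → containsGL w⊏u d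

    ILMScheme-sound : ∀ {A} → ILMScheme A → w ⊨ A
    ILMScheme-sound J1 □A⇒B u w⊏u =
      ClassicalTheory.⊢⇒-to-▷ (classicalAt w⊏u) (⊨□-elim □A⇒B w⊏u)
    ILMScheme-sound (J2 {A} {B} {C}) A▷B∧B▷C u w⊏u =
      let A▷B , B▷C = ⊨∧-elim {A = A ▷ B} {B ▷ C} A▷B∧B▷C in ▷⟨⟩-trans (A▷B u w⊏u) (B▷C u w⊏u)
    ILMScheme-sound (J3 {A} {B} {C}) B▷A∧C▷A u w⊏u =
      let B▷A , C▷A = ⊨∧-elim {A = B ▷ A} {C ▷ A} B▷A∧C▷A in
      ClassicalTheory.▷⟨⟩-join (classicalAt w⊏u) (B▷A u w⊏u) (C▷A u w⊏u)
    ILMScheme-sound J5 u w⊏u =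
      ClassicalTheory.◇▷⟨⟩ (classicalAt w⊏u) (necessitationAt w⊏u) (containsGL w⊏u)
    ILMScheme-sound M A▷B u w⊏u =
      ClassicalTheory.▷⟨⟩-□∧ (classicalAt w⊏u) (necessitationAt w⊏u) (containsGL w⊏u) (A▷B u w⊏u)

    ILM-sound : Valid w
    ILM-sound (gl d)     = GL-sound d
    ILM-sound (scheme s) = ILMScheme-sound s
    ILM-sound (boxSch s) = ⊨□-intro λ u w⊏u → containsILM w⊏u (scheme s)
    ILM-sound (mp d e)   = ILM-sound e (ILM-sound d)

  containsILM-above-valid : ∀ {w} → (∀ v → TransClosure _⊏_ w v → Valid v) →
                            ∀ {u} → w ⊏ u → ContainsILM (L u)
  containsILM-above-valid {w} valid w⊏u =
    ClassicalTheory.containsILM-from-purelyModal (classicalAt w⊏u) (necessitationAt w⊏u)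
      λ d pm → completeAt w⊏u pm (w , w⊏u , λ v w⊏⁺v → valid v w⊏⁺v d)

theorem5p5 : ExcludedMiddle 0ℓ →
    (P : PreModel) → IsProvabilityModel P → HasNecessitation P →
    ConverselyWellFounded P →
    ∀ {A} → ILM⊢ A → ∀ w → _⊩_ P w A
theorem5p5 lem P isModel necessitation cwf d w =
  cwf-induction⁺ lem cwf Valid (λ v above → ILM-sound v (containsILM-above-valid above)) w d
  where open ProvabilityModel lem P isModel necessitation
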